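{- Let $\tau\ge 2$ and $e\ge 1$ be integers. Put $$N=(2^e+1)3^{\tau-1}-2^{e+\tau-1},\qquad D=2^{e+\tau-1}-3^{\tau},$$ and assume $D>0$ and $x_{\max}:=N/D<\min\left(3^{\tau},2^{e+\tau-1}\right)$. Since $D$ is coprime to $2$ and to $3$, let $\rho_3$ be the unique integer in $\{0,1,\dots,3^{\tau}-1\}$ with $\rho_3 D\equiv N \pmod{3^{\tau}}$, and let $\rho_2$ be the unique integer in $\{0,1,\dots,2^{e+\tau-1}-1\}$ with $\rho_2 D\equiv N\pmod{2^{e+\tau-1}}$. Then the following hold. - If $\tau$ is even: $\rho_3=3^{\tau-1}-1$ when $e$ is even, and $\rho_3=3^{\tau}-1$ when $e$ is odd. - If $\tau$ is odd: $\rho_3=2\cdot 3^{\tau-1}-1$ when $e$ is even, and $\rho_3=3^{\tau}-1$ when $e$ is odd. - If $\tau$ is odd and $e$ is even, then $$\rho_2=2^e\,\frac{2^{\tau-1}-1}{3}+\frac{2^{e+\tau-1}-1}{3}=\frac{(2^{\tau}-1)2^e-1}{3}.$$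
   Context: The number $N/D$ is the maximal element of a hypothetical cycle of the accelerated $3x+1$ map $T(x)=(3x+1)/2^{v_2(3x+1)}$ on odd integers in which exactly one element $x$ satisfies $v_2(3x+1)\ge 2$. The cycle has $\tau$ elements, and the exponent sequence is $(1,\dots,1,e)$. The quantities $\rho_3$ and $\rho_2$ are the canonical residues of this rational number modulo $3^\tau$ and modulo $2^{e+\tau-1}$, respectively. -}

module Defs where

open import Data.Nat using (ℕ; suc; _+_; _∸_; _^_)
open import Data.Integer using (ℤ; +_; _-_; _*_; _≤_; _<_)
open import Data.Integer.Divisibility using (_∣_)
open import Data.Product using (_×_)

Nval : ℕ → ℕ → ℤ
Nval τ e = (+ (2 ^ e + 1)) * (+ (3 ^ (τ ∸ 1))) - + (2 ^ (e + τ ∸ 1))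

Dval : ℕ → ℕ → ℤ
Dval τ e = + (2 ^ (e + τ ∸ 1)) - + (3 ^ τ)

IsResidue : ℕ → ℤ → ℤ → ℤ → Set
IsResidue m N D ρ = (+ 0 ≤ ρ) × (ρ < + m) × (+ m ∣ (ρ * D - N))

-- Write A = 2^e, W = 2^(τ-1), P = 3^(τ-1), so that N = (A+1)P - AW and D = AW - 3P.
-- D is prime to 2 and to 3, so a canonical residue modulo a power of 2 or 3 is unique and it
-- suffices to exhibit one.  Modulo 3^τ = 3P we have (cP - 1)D - N = P(cAW + 2 - A) - 3P·cP,
-- so cP - 1 is the residue once 3 ∣ cAW + 2 - A; as 2^n ≡ 1 or 2 (mod 3) according to the
-- parity of n, this picks c ∈ {1, 2, 3} from the parities of τ and e.  Modulo 2^(e+τ-1) = AW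
-- we have cD - N ≡ -P(3c + A + 1), so for τ odd and e even, where A ≡ W ≡ 1 (mod 3), the
-- residue is c = (2AW - A - 1)/3.
module Submission where

open import Defs
open import Data.Nat using (ℕ; zero; suc; _+_; _∸_; _^_; _≥_; NonZero; s≤s; z≤n)
import Data.Nat
import Data.Nat as ℕ
import Data.Nat.Properties as ℕ
open import Data.Nat.Divisibility
  using (_∣_; _∤_; divides; ∣-trans; m∣m*n; *-monoʳ-∣; *-cancelˡ-∣; ∣1⇒≡1; _∣?_; 1∣_)
open import Data.Nat.DivMod using (_%_; m<n⇒m%n≡m; %-remove-+ˡ)
open import Data.Nat.Primality using (Prime; euclidsLemma; prime⇒nonZero; prime?; ¬prime[1]; prime[2])
open import Data.Integer using (ℤ; +_; _-_; _*_; _<_; _⊖_; ∣_∣; +≤+; +<+) renaming (_+_ to _⊕_)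
import Data.Integer.Properties as ℤ
import Data.Integer.Divisibility.Signed as Signed
open Signed using (∣m∣n⇒∣m+n; ∣m∣n⇒∣m-n; ∣m⇒∣-m; ∣m+n∣m⇒∣n; ∣m+n∣n⇒∣m; ∣n⇒∣m*n; ∣m⇒∣m*n; ∣ᵤ⇒∣; ∣⇒∣ᵤ)
  renaming (_∣_ to _∣ℤ_)
open import Data.Integer.Tactic.RingSolver using (solve-∀)
open import Data.Product using (_×_; _,_; ∃-syntax)
open import Data.Sum using (_⊎_; inj₁; inj₂; [_,_])
open import Function using (_∘_)
open import Relation.Binary.PropositionalEquality using (_≡_; refl; sym; trans; cong; cong₂; subst; subst₂; module ≡-Reasoning)
open import Relation.Nullary using (¬_; contradiction)
open import Relation.Nullary.Decidable using (from-yes; from-no)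
import Data.Nat.Tactic.RingSolver as ℕ-Ring

∤⇒∤^ : ∀ {p b} n → Prime p → p ∤ b → p ∤ b ^ n
∤⇒∤^ zero    pr p∤b p∣1 = ¬prime[1] (subst Prime (∣1⇒≡1 p∣1) pr)
∤⇒∤^ (suc n) pr p∤b     = [ p∤b , ∤⇒∤^ n pr p∤b ] ∘ euclidsLemma _ _ pr

^∣*-cancelʳ : ∀ {p n} k {m} → Prime p → p ∤ n → p ^ k ∣ m ℕ.* n → p ^ k ∣ m
^∣*-cancelʳ     zero    {m} _  _   _ = 1∣ m
^∣*-cancelʳ {p} {n} (suc k) {m} pr p∤n pᵏ⁺¹∣mn with euclidsLemma m n pr (∣-trans (m∣m*n _) pᵏ⁺¹∣mn)
... | inj₂ p∣n = contradiction p∣n p∤n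
... | inj₁ (divides q refl) =
  subst (p ℕ.* p ^ k ∣_) (ℕ.*-comm p q)
    (*-monoʳ-∣ p (^∣*-cancelʳ k pr p∤n
      (*-cancelˡ-∣ p {{prime⇒nonZero pr}} (subst (p ℕ.* p ^ k ∣_) qpn≡pqn pᵏ⁺¹∣mn))))
  where
  qpn≡pqn : q ℕ.* p ℕ.* n ≡ p ℕ.* (q ℕ.* n)
  qpn≡pqn = trans (cong (ℕ._* n) (ℕ.*-comm q p)) (ℕ.*-assoc p q n)

∣∸⇒≡ : ∀ {d m n} .{{_ : NonZero d}} → m ℕ.≤ n → n ℕ.< d → d ∣ n ∸ m → m ≡ n
∣∸⇒≡ {d} {m} {n} m≤n n<d d∣n∸m = begin
  m                ≡⟨ m<n⇒m%n≡m (ℕ.≤-<-trans m≤n n<d) ⟨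
  m % d            ≡⟨ %-remove-+ˡ m d∣n∸m ⟨
  (n ∸ m + m) % d  ≡⟨ cong (_% d) (ℕ.m∸n+n≡m m≤n) ⟩
  n % d            ≡⟨ m<n⇒m%n≡m n<d ⟩
  n                ∎
  where open ≡-Reasoning

∣∣⊖∣⇒≡ : ∀ {d m n} .{{_ : NonZero d}} → m ℕ.< d → n ℕ.< d → d ∣ ∣ m ⊖ n ∣ → m ≡ n
∣∣⊖∣⇒≡ {d} {m} {n} m<d n<d d∣m⊖n with ℕ.≤-total m n
... | inj₁ m≤n = ∣∸⇒≡ m≤n n<d (subst (d ∣_) (ℤ.∣⊖∣-≤ m≤n) d∣m⊖n)
... | inj₂ n≤m = sym (∣∸⇒≡ n≤m m<d (subst (d ∣_) (trans (ℤ.∣m⊖n∣≡∣n⊖m∣ m n) (ℤ.∣⊖∣-≤ n≤m)) d∣m⊖n))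

residue-unique : ∀ {p} k {N D ρ ρ′} → Prime p → p ∤ ∣ D ∣ →
  IsResidue (p ^ k) N D ρ → IsResidue (p ^ k) N D ρ′ → ρ ≡ ρ′
residue-unique {p} k {N} {D} pr p∤D (+≤+ {n = r} _ , +<+ r<pᵏ , pᵏ∣ρD-N)
                                    (+≤+ {n = r′} _ , +<+ r′<pᵏ , pᵏ∣ρ′D-N) =
  cong +_ (∣∣⊖∣⇒≡ {{ℕ.m^n≢0 p k {{prime⇒nonZero pr}}}} r<pᵏ r′<pᵏ
    (^∣*-cancelʳ k pr p∤D (subst (p ^ k ∣_) ∣[r-r′]*D∣≡ (∣⇒∣ᵤ pᵏ∣[r-r′]*D))))
  where
  difference : ∀ a b D N → (a * D - N) - (b * D - N) ≡ (a - b) * D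
  difference = solve-∀
  pᵏ∣[r-r′]*D : + (p ^ k) ∣ℤ (+ r - + r′) * D
  pᵏ∣[r-r′]*D = subst (+ (p ^ k) ∣ℤ_) (difference (+ r) (+ r′) D N)
    (∣m∣n⇒∣m-n (∣ᵤ⇒∣ {i = + r * D - N} pᵏ∣ρD-N) (∣ᵤ⇒∣ {i = + r′ * D - N} pᵏ∣ρ′D-N))
  ∣[r-r′]*D∣≡ : ∣ (+ r - + r′) * D ∣ ≡ ∣ r ⊖ r′ ∣ ℕ.* ∣ D ∣
  ∣[r-r′]*D∣≡ = trans (ℤ.abs-* (+ r - + r′) D) (cong (λ x → ∣ x ∣ ℕ.* ∣ D ∣) (ℤ.m-n≡m⊖n r r′))

parity : ∀ n → (2 ∣ n) ⊎ (2 ∣ suc n)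
parity zero    = inj₁ (divides 0 refl)
parity (suc n) with parity n
... | inj₁ (divides q refl) = inj₂ (divides (suc q) refl)
... | inj₂ 2∣1+n            = inj₁ 2∣1+n

2∤⇒2∣suc : ∀ {n} → ¬ 2 ∣ n → 2 ∣ suc n
2∤⇒2∣suc {n} 2∤n with parity n
... | inj₁ 2∣n   = contradiction 2∣n 2∤n
... | inj₂ 2∣1+n = 2∣1+n

2∤suc⇒2∣ : ∀ {n} → ¬ 2 ∣ suc n → 2 ∣ n
2∤suc⇒2∣ {n} 2∤1+n with parity n
... | inj₁ 2∣n   = 2∣n
... | inj₂ 2∣1+n = contradiction 2∣1+n 2∤1+n

4^≡1[mod3] : ∀ k → ∃[ u ] 2 ^ (k ℕ.* 2) ≡ 1 + 3 ℕ.* u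
4^≡1[mod3] zero = 0 , refl
4^≡1[mod3] (suc k) with 4^≡1[mod3] k
... | u , eq = 1 + 4 ℕ.* u , trans (cong (λ x → 2 ℕ.* (2 ℕ.* x)) eq) (step u)
  where
  step : ∀ u → 2 ℕ.* (2 ℕ.* (1 + 3 ℕ.* u)) ≡ 1 + 3 ℕ.* (1 + 4 ℕ.* u)
  step = ℕ-Ring.solve-∀

2^even≡1[mod3] : ∀ {n} → 2 ∣ n → ∃[ u ] 2 ^ n ≡ 1 + 3 ℕ.* u
2^even≡1[mod3] (divides k refl) = 4^≡1[mod3] k

2^odd≡2[mod3] : ∀ {n} → 2 ∣ suc n → ∃[ u ] 2 ^ n ≡ 2 + 3 ℕ.* u
2^odd≡2[mod3] (divides (suc k) refl) with 4^≡1[mod3] k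
... | u , eq = 2 ℕ.* u , trans (cong (2 ℕ.*_) eq) (step u)
  where
  step : ∀ u → 2 ℕ.* (1 + 3 ℕ.* u) ≡ 2 + 3 ℕ.* (2 ℕ.* u)
  step = ℕ-Ring.solve-∀

+[a+b*c] : ∀ a b c → + (a + b ℕ.* c) ≡ + a ⊕ + b * + c
+[a+b*c] a b c = trans (ℤ.pos-+ a (b ℕ.* c)) (cong (+ a ⊕_) (ℤ.pos-* b c))

≡a+3u⇒≡a[mod3] : ∀ {n a} → ∃[ u ] n ≡ a + 3 ℕ.* u → + 3 ∣ℤ + n - + a
≡a+3u⇒≡a[mod3] {n} {a} (u , eq) = Signed.divides (+ u) (begin
  + n - + a                ≡⟨ cong (_- + a) (trans (cong +_ eq) (+[a+b*c] a 3 u)) ⟩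
  + a ⊕ + 3 * + u - + a    ≡⟨ cancel (+ a) (+ u) ⟩
  + u * + 3                ∎)
  where
  open ≡-Reasoning
  cancel : ∀ a u → a ⊕ + 3 * u - a ≡ u * + 3
  cancel = solve-∀

cycleN cycleD : ℤ → ℤ → ℤ → ℤ
cycleN A W P = (A ⊕ + 1) * P - A * W
cycleD A W P = A * W - + 3 * P

2^[e+τ∸1] : ∀ s e → 2 ^ (e + suc s ∸ 1) ≡ 2 ^ e ℕ.* 2 ^ s
2^[e+τ∸1] s e = trans (cong (λ n → 2 ^ (n ∸ 1)) (ℕ.+-suc e s)) (ℕ.^-distribˡ-+-* 2 e s)

+2^[e+τ∸1] : ∀ s e → + (2 ^ (e + suc s ∸ 1)) ≡ + (2 ^ e) * + (2 ^ s)
+2^[e+τ∸1] s e = trans (cong +_ (2^[e+τ∸1] s e)) (ℤ.pos-* (2 ^ e) (2 ^ s))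

Nval≡cycleN : ∀ s e → Nval (suc s) e ≡ cycleN (+ (2 ^ e)) (+ (2 ^ s)) (+ (3 ^ s))
Nval≡cycleN s e = cong₂ (λ a b → a * + (3 ^ s) - b) (ℤ.pos-+ (2 ^ e) 1) (+2^[e+τ∸1] s e)

Dval≡cycleD : ∀ s e → Dval (suc s) e ≡ cycleD (+ (2 ^ e)) (+ (2 ^ s)) (+ (3 ^ s))
Dval≡cycleD s e = cong₂ _-_ (+2^[e+τ∸1] s e) (ℤ.pos-* 3 (3 ^ s))

3∤Dval : ∀ s e → 3 ∤ ∣ Dval (suc s) e ∣
3∤Dval s e 3∣D = ∤⇒∤^ (e + suc s ∸ 1) (from-yes (prime? 3)) (from-no (3 ∣? 2))
  (∣⇒∣ᵤ {+ 3} {+ (2 ^ (e + suc s ∸ 1))}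
    (∣m+n∣n⇒∣m (∣ᵤ⇒∣ {i = Dval (suc s) e} 3∣D)
               (∣m⇒∣-m (∣ᵤ⇒∣ {+ 3} {+ (3 ^ suc s)} (m∣m*n (3 ^ s))))))

2∤Dval : ∀ s {e} → e ≥ 1 → 2 ∤ ∣ Dval (suc s) e ∣
2∤Dval s {suc e} _ 2∣D = ∤⇒∤^ (suc s) prime[2] (from-no (2 ∣? 3))
  (∣⇒∣ᵤ {i = + (3 ^ suc s)} (subst (+ 2 ∣ℤ_) (ℤ.neg-involutive _)
    (∣m⇒∣-m (∣m+n∣m⇒∣n (∣ᵤ⇒∣ {i = Dval (suc s) (suc e)} 2∣D) 2∣2^[e+τ∸1]))))
  where
  2∣2^[e+τ∸1] : + 2 ∣ℤ + (2 ^ (suc e + suc s ∸ 1))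
  2∣2^[e+τ∸1] = subst (+ 2 ∣ℤ_) (sym (+2^[e+τ∸1] s (suc e)))
    (∣m⇒∣m*n (+ (2 ^ s)) (∣ᵤ⇒∣ {i = + (2 ^ suc e)} (m∣m*n (2 ^ e))))

+X-1-residue : ∀ {m N D X} → 1 ℕ.≤ X → X ℕ.≤ m →
  + m ∣ℤ (+ X - + 1) * D - N → IsResidue m N D (+ X - + 1)
+X-1-residue {m} {N} {D} {X} 1≤X X≤m m∣ = subst (IsResidue m N D) (sym +X-1≡)
  ( +≤+ z≤n
  , +<+ (subst (ℕ._≤ m) (sym (ℕ.m+[n∸m]≡n 1≤X)) X≤m)
  , ∣⇒∣ᵤ (subst (λ x → + m ∣ℤ x * D - N) +X-1≡ m∣))
  where
  +X-1≡ : + X - + 1 ≡ + (X ∸ 1)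
  +X-1≡ = trans (ℤ.m-n≡m⊖n X 1) (ℤ.⊖-≥ 1≤X)

[cP-1]D≡N[mod3P] : ∀ c A W P → + 3 ∣ℤ c * A * W ⊕ + 2 - A →
  + 3 * P ∣ℤ (c * P - + 1) * cycleD A W P - cycleN A W P
[cP-1]D≡N[mod3P] c A W P 3∣X = subst (+ 3 * P ∣ℤ_) (identity c A W P)
  (∣m∣n⇒∣m-n (Signed.*-monoˡ-∣ P 3∣X) (∣m⇒∣m*n (c * P) Signed.∣-refl))
  where
  identity : ∀ c A W P → (c * A * W ⊕ + 2 - A) * P - + 3 * P * (c * P)
                       ≡ (c * P - + 1) * (A * W - + 3 * P) - ((A ⊕ + 1) * P - A * W)
  identity = solve-∀

cAW+2-A-cong[mod] : ∀ {m} c {A W a w} → m ∣ℤ A - a → m ∣ℤ W - w →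
  m ∣ℤ c * a * w ⊕ + 2 - a → m ∣ℤ c * A * W ⊕ + 2 - A
cAW+2-A-cong[mod] {m} c {A} {W} {a} {w} A≡a W≡w m∣X = subst (m ∣ℤ_) (identity c A W a w)
  (∣m∣n⇒∣m+n (∣m∣n⇒∣m+n m∣X (∣n⇒∣m*n (c * W - + 1) A≡a)) (∣n⇒∣m*n (c * a) W≡w))
  where
  identity : ∀ c A W a w → c * a * w ⊕ + 2 - a ⊕ (c * W - + 1) * (A - a) ⊕ c * a * (W - w)
                         ≡ c * A * W ⊕ + 2 - A
  identity = solve-∀

residue-mod-3^τ≡cP-1 : ∀ s e c a w {ρ} → 1 ℕ.≤ c → c ℕ.≤ 3 →
  + 3 ∣ℤ + (2 ^ e) - + a → + 3 ∣ℤ + (2 ^ s) - + w → + 3 ∣ℤ + c * + a * + w ⊕ + 2 - + a →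
  IsResidue (3 ^ suc s) (Nval (suc s) e) (Dval (suc s) e) ρ → ρ ≡ + (c ℕ.* 3 ^ s) - + 1
residue-mod-3^τ≡cP-1 s e c a w 1≤c c≤3 A≡a W≡w 3∣X isr =
  residue-unique (suc s) (from-yes (prime? 3)) (3∤Dval s e) isr
    (+X-1-residue (ℕ.*-mono-≤ 1≤c (ℕ.m^n>0 3 s)) (ℕ.*-monoˡ-≤ (3 ^ s) c≤3) divisible)
  where
  A W P : ℤ
  A = + (2 ^ e)
  W = + (2 ^ s)
  P = + (3 ^ s)
  cast : (+ (c ℕ.* 3 ^ s) - + 1) * Dval (suc s) e - Nval (suc s) e
       ≡ (+ c * P - + 1) * cycleD A W P - cycleN A W P
  cast = trans (cong₂ (λ x d → (x - + 1) * d - Nval (suc s) e) (ℤ.pos-* c (3 ^ s)) (Dval≡cycleD s e))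
               (cong (λ n → (+ c * P - + 1) * cycleD A W P - n) (Nval≡cycleN s e))
  divisible : + (3 ^ suc s) ∣ℤ (+ (c ℕ.* 3 ^ s) - + 1) * Dval (suc s) e - Nval (suc s) e
  divisible = subst₂ _∣ℤ_ (sym (ℤ.pos-* 3 (3 ^ s))) (sym cast)
    ([cP-1]D≡N[mod3P] (+ c) A W P (cAW+2-A-cong[mod] (+ c) A≡a W≡w 3∣X))

-- (2AW - A - 1)/3 for A = 1 + 3u and W = 1 + 3v
ρ₂-candidate : ℕ → ℕ → ℕ
ρ₂-candidate u v = u + (2 + 6 ℕ.* u) ℕ.* v

+ρ₂-candidate : ∀ u v → + ρ₂-candidate u v ≡ + u ⊕ (+ 2 ⊕ + 6 * + u) * + v
+ρ₂-candidate u v = trans (+[a+b*c] u (2 + 6 ℕ.* u) v) (cong (λ x → + u ⊕ x * + v) (+[a+b*c] 2 6 u))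

ρ₂-candidate<AW : ∀ u v → ρ₂-candidate u v ℕ.< (1 + 3 ℕ.* u) ℕ.* (1 + 3 ℕ.* v)
ρ₂-candidate<AW u v = subst (suc (ρ₂-candidate u v) ℕ.≤_) (complement u v) (ℕ.m≤m+n _ _)
  where
  complement : ∀ u v → suc (u + (2 + 6 ℕ.* u) ℕ.* v) + (2 ℕ.* u + v + 3 ℕ.* u ℕ.* v)
                     ≡ (1 + 3 ℕ.* u) ℕ.* (1 + 3 ℕ.* v)
  complement = ℕ-Ring.solve-∀

cD-N≡[c+1-2P]AW : ∀ {A W c} u v P → A ≡ + 1 ⊕ + 3 * u → W ≡ + 1 ⊕ + 3 * v → c ≡ u ⊕ (+ 2 ⊕ + 6 * u) * v →
  c * cycleD A W P - cycleN A W P ≡ (c ⊕ + 1 - + 2 * P) * (A * W)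
cD-N≡[c+1-2P]AW u v P refl refl refl = identity u v P
  where
  identity : ∀ u v P → (u ⊕ (+ 2 ⊕ + 6 * u) * v) * ((+ 1 ⊕ + 3 * u) * (+ 1 ⊕ + 3 * v) - + 3 * P)
                       - ((+ 1 ⊕ + 3 * u ⊕ + 1) * P - (+ 1 ⊕ + 3 * u) * (+ 1 ⊕ + 3 * v))
                     ≡ (u ⊕ (+ 2 ⊕ + 6 * u) * v ⊕ + 1 - + 2 * P) * ((+ 1 ⊕ + 3 * u) * (+ 1 ⊕ + 3 * v))
  identity = solve-∀

ρ₂-candidate-residue : ∀ s e u v → 2 ^ e ≡ 1 + 3 ℕ.* u → 2 ^ s ≡ 1 + 3 ℕ.* v →
  IsResidue (2 ^ (e + suc s ∸ 1)) (Nval (suc s) e) (Dval (suc s) e) (+ ρ₂-candidate u v)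
ρ₂-candidate-residue s e u v A≡ W≡ =
  subst (λ m → IsResidue m (Nval (suc s) e) (Dval (suc s) e) (+ c)) (sym (2^[e+τ∸1] s e))
    (+≤+ z≤n , +<+ (subst (c ℕ.<_) (sym (cong₂ ℕ._*_ A≡ W≡)) (ρ₂-candidate<AW u v)) , ∣⇒∣ᵤ divisible)
  where
  open ≡-Reasoning
  c : ℕ
  c = ρ₂-candidate u v
  A W P q : ℤ
  A = + (2 ^ e)
  W = + (2 ^ s)
  P = + (3 ^ s)
  q = + c ⊕ + 1 - + 2 * P
  divisible : + (2 ^ e ℕ.* 2 ^ s) ∣ℤ + c * Dval (suc s) e - Nval (suc s) e
  divisible = Signed.divides q (begin
    + c * Dval (suc s) e - Nval (suc s) e
      ≡⟨ cong₂ (λ d n → + c * d - n) (Dval≡cycleD s e) (Nval≡cycleN s e) ⟩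
    + c * cycleD A W P - cycleN A W P
      ≡⟨ cD-N≡[c+1-2P]AW (+ u) (+ v) P (trans (cong +_ A≡) (+[a+b*c] 1 3 u))
                                       (trans (cong +_ W≡) (+[a+b*c] 1 3 v)) (+ρ₂-candidate u v) ⟩
    q * (A * W)
      ≡⟨ cong (q *_) (ℤ.pos-* (2 ^ e) (2 ^ s)) ⟨
    q * + (2 ^ e ℕ.* 2 ^ s) ∎)

3*residue-mod-2^[e+τ∸1] : ∀ s e {ρ} → e ≥ 1 → ∃[ u ] 2 ^ e ≡ 1 + 3 ℕ.* u → ∃[ v ] 2 ^ s ≡ 1 + 3 ℕ.* v →
  IsResidue (2 ^ (e + suc s ∸ 1)) (Nval (suc s) e) (Dval (suc s) e) ρ →
  + 3 * ρ ≡ (+ (2 ^ suc s) - + 1) * + (2 ^ e) - + 1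
3*residue-mod-2^[e+τ∸1] s e {ρ} e≥1 (u , A≡) (v , W≡) isr = begin
  + 3 * ρ                                   ≡⟨ cong (+ 3 *_) ρ≡c ⟩
  + 3 * + ρ₂-candidate u v                  ≡⟨ cong (+ 3 *_) (+ρ₂-candidate u v) ⟩
  + 3 * (+ u ⊕ (+ 2 ⊕ + 6 * + u) * + v)     ≡⟨ three-c (+ u) (+ v) ⟩
  (+ 2 * W′ - + 1) * A′ - + 1               ≡⟨ cong₂ (λ w a → (+ 2 * w - + 1) * a - + 1) +W≡ +A≡ ⟨
  (+ 2 * + (2 ^ s) - + 1) * + (2 ^ e) - + 1 ≡⟨ cong (λ w → (w - + 1) * + (2 ^ e) - + 1) (ℤ.pos-* 2 (2 ^ s)) ⟨
  (+ (2 ^ suc s) - + 1) * + (2 ^ e) - + 1   ∎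
  where
  open ≡-Reasoning
  A′ W′ : ℤ
  A′ = + 1 ⊕ + 3 * + u
  W′ = + 1 ⊕ + 3 * + v
  +A≡ : + (2 ^ e) ≡ A′
  +A≡ = trans (cong +_ A≡) (+[a+b*c] 1 3 u)
  +W≡ : + (2 ^ s) ≡ W′
  +W≡ = trans (cong +_ W≡) (+[a+b*c] 1 3 v)
  three-c : ∀ u v → + 3 * (u ⊕ (+ 2 ⊕ + 6 * u) * v) ≡ (+ 2 * (+ 1 ⊕ + 3 * v) - + 1) * (+ 1 ⊕ + 3 * u) - + 1
  three-c = solve-∀
  ρ≡c : ρ ≡ + ρ₂-candidate u v
  ρ≡c = residue-unique (e + suc s ∸ 1) prime[2] (2∤Dval s e≥1) isr (ρ₂-candidate-residue s e u v A≡ W≡)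

2^τ-form≡2^[e+τ∸1]-form : ∀ s e →
  (+ (2 ^ suc s) - + 1) * + (2 ^ e) - + 1 ≡ + (2 ^ e) * (+ (2 ^ s) - + 1) ⊕ (+ (2 ^ (e + suc s ∸ 1)) - + 1)
2^τ-form≡2^[e+τ∸1]-form s e = begin
  (+ (2 ^ suc s) - + 1) * A - + 1     ≡⟨ cong (λ x → (x - + 1) * A - + 1) (ℤ.pos-* 2 (2 ^ s)) ⟩
  (+ 2 * W - + 1) * A - + 1           ≡⟨ identity A W ⟩
  A * (W - + 1) ⊕ (A * W - + 1)       ≡⟨ cong (λ x → A * (W - + 1) ⊕ (x - + 1)) (+2^[e+τ∸1] s e) ⟨
  A * (W - + 1) ⊕ (+ (2 ^ (e + suc s ∸ 1)) - + 1) ∎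
  where
  open ≡-Reasoning
  A W : ℤ
  A = + (2 ^ e)
  W = + (2 ^ s)
  identity : ∀ A W → (+ 2 * W - + 1) * A - + 1 ≡ A * (W - + 1) ⊕ (A * W - + 1)
  identity = solve-∀

mainTheorem1 : (τ e : ℕ) → τ ≥ 2 → e ≥ 1 →
    + 0 < Dval τ e →
    Nval τ e < Dval τ e * + (3 ^ τ) →
    Nval τ e < Dval τ e * + (2 ^ (e + τ ∸ 1)) →
    (∀ (ρ₃ : ℤ) → IsResidue (3 ^ τ) (Nval τ e) (Dval τ e) ρ₃ →
        (2 ∣ τ → 2 ∣ e → ρ₃ ≡ + (3 ^ (τ ∸ 1)) - + 1)
      × (2 ∣ τ → ¬ (2 ∣ e) → ρ₃ ≡ + (3 ^ τ) - + 1)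
      × (¬ (2 ∣ τ) → 2 ∣ e → ρ₃ ≡ + (2 Data.Nat.* 3 ^ (τ ∸ 1)) - + 1)
      × (¬ (2 ∣ τ) → ¬ (2 ∣ e) → ρ₃ ≡ + (3 ^ τ) - + 1))
    × (∀ (ρ₂ : ℤ) → IsResidue (2 ^ (e + τ ∸ 1)) (Nval τ e) (Dval τ e) ρ₂ →
        ¬ (2 ∣ τ) → 2 ∣ e →
          (+ 3 * ρ₂ ≡ + (2 ^ e) * (+ (2 ^ (τ ∸ 1)) - + 1) ⊕ (+ (2 ^ (e + τ ∸ 1)) - + 1))
        × (+ 3 * ρ₂ ≡ (+ (2 ^ τ) - + 1) * + (2 ^ e) - + 1))
mainTheorem1 (suc s) e (s≤s _) e≥1 _ _ _ =
    (λ ρ isr →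
        (λ 2∣τ 2∣e →
          trans (residue-mod-3^τ≡cP-1 s e 1 1 2 (s≤s z≤n) (s≤s z≤n)
                   (even⇒2^≡1 2∣e) (odd⇒2^≡2 2∣τ) (Signed.divides (+ 1) refl) isr)
                (cong (λ x → + x - + 1) (ℕ.*-identityˡ (3 ^ s))))
      , (λ 2∣τ 2∤e →
          residue-mod-3^τ≡cP-1 s e 3 2 2 (s≤s z≤n) ℕ.≤-refl
            (odd⇒2^≡2 (2∤⇒2∣suc 2∤e)) (odd⇒2^≡2 2∣τ) (Signed.divides (+ 4) refl) isr)
      , (λ 2∤τ 2∣e →
          residue-mod-3^τ≡cP-1 s e 2 1 1 (s≤s z≤n) (s≤s (s≤s z≤n))
            (even⇒2^≡1 2∣e) (even⇒2^≡1 (2∤suc⇒2∣ 2∤τ)) (Signed.divides (+ 1) refl) isr)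
      , (λ 2∤τ 2∤e →
          residue-mod-3^τ≡cP-1 s e 3 2 1 (s≤s z≤n) ℕ.≤-refl
            (odd⇒2^≡2 (2∤⇒2∣suc 2∤e)) (even⇒2^≡1 (2∤suc⇒2∣ 2∤τ)) (Signed.divides (+ 2) refl) isr))
  , (λ ρ isr 2∤τ 2∣e →
      let 3ρ≡ = 3*residue-mod-2^[e+τ∸1] s e e≥1 (2^even≡1[mod3] 2∣e) (2^even≡1[mod3] (2∤suc⇒2∣ 2∤τ)) isr
      in trans 3ρ≡ (2^τ-form≡2^[e+τ∸1]-form s e) , 3ρ≡)
  where
  even⇒2^≡1 : ∀ {n} → 2 ∣ n → + 3 ∣ℤ + (2 ^ n) - + 1
  even⇒2^≡1 2∣n = ≡a+3u⇒≡a[mod3] (2^even≡1[mod3] 2∣n)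
  odd⇒2^≡2 : ∀ {n} → 2 ∣ suc n → + 3 ∣ℤ + (2 ^ n) - + 2
  odd⇒2^≡2 2∣1+n = ≡a+3u⇒≡a[mod3] (2^odd≡2[mod3] 2∣1+n)
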